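{- For every finite abelian group $G$ we have $d_{\min}(G)=\operatorname{rk}(G)$.
   Context: For a finite abelian group $G$ with $n=|G|$, let $\mathcal C(G)$ be the set of Hamiltonian cycles in the complete digraph on vertex set $G$; a cycle is written $C=(g_1,\ldots,g_n)$, a listing of all elements of $G$, with directed edges $(g_i,g_{i+1})$, indices taken modulo $n$. Let $D(C)=\{g_{i+1}-g_i : 1\le i\le n\}$ (indices mod $n$) be the set of differences along $C$, and $d_{\min}(G)=\min\{|D(C)| : C\in\mathcal C(G)\}$, with the convention $\min\varnothing=0$ (so $d_{\min}(G)=0$ for trivial $G$). $\operatorname{rk}(G)$ denotes the rank of $G$, i.e. the minimum number of generators. -}

module Defs where

open import Level using (0ℓ)
open import Data.Nat as ℕ using (ℕ; zero; suc; _≤_)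
open import Data.Integer as ℤ using (ℤ; +_; -[1+_])
open import Data.Fin as Fin using (Fin; toℕ; fromℕ<)
open import Data.Product using (Σ; ∃; ∃-syntax; _×_; _,_)
open import Data.Sum using (_⊎_)
open import Relation.Nullary using (¬_; yes; no)
open import Relation.Binary.PropositionalEquality using (_≡_)
open import Algebra.Structures using (IsAbelianGroup)
open import Function.Bundles using (_↔_)

record FinAbGroup : Set₁ where
  infixl 6 _+_ _-_
  field
    Carrier        : Set
    _+_            : Carrier → Carrier → Carrier
    0g             : Carrier
    -_             : Carrier → Carrier
    isAbelianGroup : IsAbelianGroup {A = Carrier} _≡_ _+_ 0g -_
    size           : ℕ
    enum           : Fin size ↔ Carrier

  _-_ : Carrier → Carrier → Carrier
  x - y = x + (- y)

  nmul : ℕ → Carrier → Carrier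
  nmul zero    x = 0g
  nmul (suc n) x = x + nmul n x

  zmul : ℤ → Carrier → Carrier
  zmul (+ n)      x = nmul n x
  zmul -[1+ n ]   x = - nmul (suc n) x

  sumFin : ∀ {k} → (Fin k → Carrier) → Carrier
  sumFin {zero}  f = 0g
  sumFin {suc k} f = f Fin.zero + sumFin (λ j → f (Fin.suc j))

open FinAbGroup public

IsLeast : (ℕ → Set) → ℕ → Set
IsLeast P m = P m × (∀ k → P k → m ≤ k)

Generates : (G : FinAbGroup) {k : ℕ} → (Fin k → Carrier G) → Set
Generates G {k} g =
  ∀ x → Σ (Fin k → ℤ) λ a → x ≡ sumFin G {k} (λ j → zmul G (a j) (g j))

IsRank : FinAbGroup → ℕ → Set
IsRank G = IsLeast (λ k → Σ (Fin k → Carrier G) λ g → Generates G {k} g)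

nextFin : ∀ {n} → Fin n → Fin n
nextFin {suc n} i with suc (toℕ i) ℕ.<? suc n
... | yes p = fromℕ< p
... | no _  = Fin.zero

-- A Hamiltonian cycle in the complete digraph (no loops) on G:
-- a listing c 0, …, c (n-1) of all elements of G (a bijection Fin n → G),
-- which requires n ≥ 2 (there is no Hamiltonian cycle on one vertex).
record HamCycle (G : FinAbGroup) : Set where
  field
    two≤n     : 2 ≤ size G
    c         : Fin (size G) → Carrier G
    injective : ∀ i j → c i ≡ c j → i ≡ j
    surjective : ∀ x → ∃[ i ] (c i ≡ x)

  diff : Fin (size G) → Carrier G
  diff i = _-_ G (c (nextFin i)) (c i)

open HamCycle public

ImageCard : {A : Set} {n : ℕ} → (Fin n → A) → ℕ → Set
ImageCard {A} {n} f d =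
  Σ (Fin d → A) λ e →
    (∀ j j′ → e j ≡ e j′ → j ≡ j′) ×
    (∀ j → ∃[ i ] (e j ≡ f i)) ×
    (∀ i → ∃[ j ] (f i ≡ e j))

DiffCard : {G : FinAbGroup} → HamCycle G → ℕ → Set
DiffCard C d = ImageCard (diff C) d

-- d_min(G) = d, with the convention min ∅ = 0
IsDmin : FinAbGroup → ℕ → Set
IsDmin G d =
  (¬ HamCycle G × d ≡ 0) ⊎
  IsLeast (λ k → Σ (HamCycle G) λ C → DiffCard C k) d

-- Along a Hamiltonian cycle every element is reached from any other by adding
-- differences, so D(C) generates G and |D(C)| ≥ rk G.
-- Conversely, let g₁, …, g_k generate G and Hⱼ = ⟨gⱼ, …, g_k⟩.  Suppose r₀, …, r_l
-- represent the cosets of Hⱼ, with every step r_{i+1} − r_i, and the closing step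
-- r₀ − r_l up to Hⱼ, in a set T.  If m is the order of gⱼ modulo H_{j+1}, the elements
-- r_i + s gⱼ (s < m), listed with s as the slow digit, represent the cosets of H_{j+1};
-- their steps lie in T plus the single new element r₀ + gⱼ − r_l, and the closing step
-- is right up to m gⱼ ∈ H_{j+1}.  Going from H₁ = G down to H_{k+1} = 0 yields a
-- Hamiltonian cycle with at most k differences.
module Submission where

open import Defs hiding (_+_)
open import Data.Nat using (ℕ)
open import Data.Product using (∃-syntax; _×_)

open import Level using (0ℓ)
open import Algebra.Bundles using (AbelianGroup)
open import Data.Fin using (Fin; zero; suc; toℕ; fromℕ<; inject₁)
open import Data.Fin.Base using (finToFun; funToFin)
open import Data.Fin.Induction using (<-weakInduction)
open import Data.Fin.Properties
  using (toℕ-injective; toℕ<n; toℕ-fromℕ<; inject₁ℕ<; toℕ-inject₁; any?; all?; inj⇒≟; pigeonhole;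
         cantor-schröder-bernstein; finToFun-funToFin)
open import Data.List using (List; []; _∷_; length; tabulate; lookup; filter; deduplicate)
open import Data.List.Membership.Propositional using (_∈_)
open import Data.List.Membership.Propositional.Properties
  using (∈-lookup; ∈-filter⁺; ∈-filter⁻; ∈-deduplicate⁺; ∈-deduplicate⁻; ∈-tabulate⁺)
open import Data.List.Properties
  using (length-filter; length-deduplicate; tabulate-cong; length-tabulate)
open import Data.List.Relation.Unary.All as All using ()
open import Data.List.Relation.Unary.Any using (here; there; index)
open import Data.List.Relation.Unary.Any.Properties using (lookup-index)
open import Data.List.Relation.Unary.AllPairs using (_∷_)
open import Data.List.Relation.Unary.Unique.Propositional using (Unique)
open import Data.List.Relation.Unary.Unique.DecPropositional.Properties using (deduplicate-!)
open import Data.Nat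
  using (NonZero; zero; suc; _+_; _*_; _%_; _/_; _≤_; _<_; _≮_; z≤n; s≤s; s≤s⁻¹; _≤?_; _<?_)
open import Data.Nat.Properties
  using (n<1+n; +-suc; *-suc; +-identityʳ; m≤n⇒∃[o]m+o≡n; m≤n+m; ≤-refl; ≤-reflexive; ≤-trans;
         ≤-antisym; ≤-total; <-≤-trans; <⇒≱; ≮⇒≥; ≰⇒>; n<1⇒n≡0; m≤n⇒m<n∨m≡n; suc-injective;
         +-monoˡ-<; *-monoˡ-≤)
open import Data.Nat.DivMod
  using (m≡m%n+[m/n]*n; m%n<n; [m+kn]%n≡m%n; m<n⇒m%n≡m; +-distrib-/-∣ʳ; m<n⇒m/n≡0; m*n/n≡m;
         m<n*o⇒m/o<n)
open import Data.Nat.Divisibility using (n∣m*n)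
open import Data.Integer using (ℤ; +_; -[1+_])
open import Data.Product using (Σ; ∃; _,_; proj₁; proj₂)
open import Data.Sum using (_⊎_; inj₁; inj₂)
open import Function using (_∘_; Inverse; Injection)
open import Function.Properties.Inverse using (↔-sym; ↔⇒↣)
open import Relation.Binary.Bundles using (Setoid)
open import Relation.Binary.Definitions using (DecidableEquality)
open import Relation.Binary.PropositionalEquality
import Relation.Binary.Reasoning.Setoid as SetoidReasoning
open import Relation.Nullary using (¬_; Dec; yes; no; contradiction)
open import Relation.Nullary.Decidable using (map′)
open import Relation.Unary using (Pred; Decidable)

least-witness : (P : ℕ → Set) → Decidable P → ∀ {n} → P n → ∃ (IsLeast P)
least-witness P P? {zero} p = 0 , p , λ _ _ → z≤n
least-witness P P? {suc n} p with P? 0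
... | yes p₀ = 0 , p₀ , λ _ _ → z≤n
... | no ¬p₀ with least-witness (P ∘ suc) (P? ∘ suc) p
...   | m , pm , m-least =
  suc m , pm , λ { zero p₀ → contradiction p₀ ¬p₀ ; (suc k) pk → s≤s (m-least k pk) }

[m+kn]%n≡m : ∀ {m} k {n} .{{_ : NonZero n}} → m < n → (m + k * n) % n ≡ m
[m+kn]%n≡m {m} k {n} m<n = trans ([m+kn]%n≡m%n m k n) (m<n⇒m%n≡m m<n)

[m+kn]/n≡k : ∀ {m} k {n} .{{_ : NonZero n}} → m < n → (m + k * n) / n ≡ k
[m+kn]/n≡k {m} k {n} m<n =
  trans (+-distrib-/-∣ʳ m (n∣m*n k)) (cong₂ _+_ (m<n⇒m/n≡0 m<n) (m*n/n≡m k n))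

toℕ-nextFin-< : ∀ {n} (i : Fin n) → suc (toℕ i) < n → toℕ (nextFin i) ≡ suc (toℕ i)
toℕ-nextFin-< {suc n} i i+1<n with suc (toℕ i) <? suc n
... | yes i+1<n′ = toℕ-fromℕ< i+1<n′
... | no  i+1≮n  = contradiction i+1<n i+1≮n

toℕ-nextFin-≮ : ∀ {n} (i : Fin n) → suc (toℕ i) ≮ n → toℕ (nextFin i) ≡ 0
toℕ-nextFin-≮ {suc n} i i+1≮n with suc (toℕ i) <? suc n
... | yes i+1<n = contradiction i+1<n i+1≮n
... | no  _     = refl

nextFin-inject₁ : ∀ {n} (i : Fin n) → nextFin (inject₁ i) ≡ suc i
nextFin-inject₁ i = toℕ-injective (begin
  toℕ (nextFin (inject₁ i)) ≡⟨ toℕ-nextFin-< (inject₁ i) (s≤s (inject₁ℕ< i)) ⟩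
  suc (toℕ (inject₁ i))     ≡⟨ cong suc (toℕ-inject₁ i) ⟩
  suc (toℕ i)               ∎)
  where open ≡-Reasoning

nextFin-induction : ∀ {n} (P : Pred (Fin (suc n)) 0ℓ) →
                    P zero → (∀ i → P i → P (nextFin i)) → ∀ i → P i
nextFin-induction P P₀ P-next =
  <-weakInduction P P₀ λ i → subst P (nextFin-inject₁ i) ∘ P-next (inject₁ i)

Unique⇒lookup-injective : ∀ {A : Set} {xs : List A} → Unique xs →
                          ∀ i j → lookup xs i ≡ lookup xs j → i ≡ j
Unique⇒lookup-injective (_ ∷ _)  zero    zero    _  = refl
Unique⇒lookup-injective (x∉ ∷ _) zero    (suc j) eq = contradiction eq (All.lookup x∉ (∈-lookup j))
Unique⇒lookup-injective (x∉ ∷ _) (suc i) zero    eq = contradiction (sym eq) (All.lookup x∉ (∈-lookup i))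
Unique⇒lookup-injective (_ ∷ u)  (suc i) (suc j) eq = cong suc (Unique⇒lookup-injective u i j eq)

module _ {A : Set} (_≟_ : DecidableEquality A) where

  imageCard-≤-length : ∀ {n} (f : Fin n → A) (T : List A) → (∀ i → f i ∈ T) →
                       ∃[ d ] (d ≤ length T × ImageCard f d)
  imageCard-≤-length f T f∈T =
    length U , ≤-trans (length-deduplicate _≟_ V) (length-filter in-image? T) ,
    lookup U , Unique⇒lookup-injective (deduplicate-! _≟_ V) ,
    (λ j → proj₂ (∈-filter⁻ in-image? {xs = T} (∈-deduplicate⁻ _≟_ V (∈-lookup j)))) ,
    λ i → let fi∈U = ∈-deduplicate⁺ _≟_ (∈-filter⁺ in-image? (f∈T i) (i , refl))
          in index fi∈U , lookup-index fi∈U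
    where
    in-image? : Decidable (λ x → ∃ λ i → x ≡ f i)
    in-image? x = any? (λ i → x ≟ f i)
    V U : List A
    V = filter in-image? T
    U = deduplicate _≟_ V

module _ (G : FinAbGroup) where

  abelianGroup : AbelianGroup 0ℓ 0ℓ
  abelianGroup = record
    { Carrier = Carrier G ; _≈_ = _≡_ ; _∙_ = FinAbGroup._+_ G ; ε = 0g G ; _⁻¹ = -_ G
    ; isAbelianGroup = isAbelianGroup G }

  open AbelianGroup abelianGroup
    using (_∙_; ε; _⁻¹; assoc; comm; identityˡ; identityʳ; inverseʳ; commutativeMonoid)
    renaming (_-_ to _−_)
  open import Algebra.Properties.AbelianGroup abelianGroup
    using (∙-cancelˡ; ⁻¹-∙-comm; ⁻¹-anti-homo‿-; ε⁻¹≈ε; inverseʳ-unique; x∙y⁻¹≈ε⇒x≈y;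
           //-rightDividesˡ; //-rightDividesʳ)
  open import Algebra.Properties.CommutativeSemigroup (AbelianGroup.commutativeSemigroup abelianGroup)
    using (interchange)
  open import Algebra.Properties.CommutativeMonoid.Mult commutativeMonoid
    using (×-homo-+; ×-assocˡ) renaming (_×_ to _·_)

  ∙-−-interchange : ∀ a b c d → (a ∙ b) − (c ∙ d) ≡ (a − c) ∙ (b − d)
  ∙-−-interchange a b c d = begin
    (a ∙ b) ∙ (c ∙ d) ⁻¹      ≡⟨ cong ((a ∙ b) ∙_) (⁻¹-∙-comm c d) ⟨
    (a ∙ b) ∙ (c ⁻¹ ∙ d ⁻¹)   ≡⟨ interchange a b (c ⁻¹) (d ⁻¹) ⟩
    (a − c) ∙ (b − d)         ∎
    where open ≡-Reasoning

  x−ε≡x : ∀ x → x − ε ≡ x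
  x−ε≡x x = trans (cong (x ∙_) ε⁻¹≈ε) (identityʳ x)

  −-∙-assoc : ∀ x a b → (x − a) − b ≡ x − (a ∙ b)
  −-∙-assoc x a b = trans (assoc x (a ⁻¹) (b ⁻¹)) (cong (x ∙_) (⁻¹-∙-comm a b))

  ∙-−-cancelʳ : ∀ a b c → (a ∙ c) − (b ∙ c) ≡ a − b
  ∙-−-cancelʳ a b c =
    trans (∙-−-interchange a c b c) (trans (cong ((a − b) ∙_) (inverseʳ c)) (identityʳ (a − b)))

  ∙-−-cancelˡ : ∀ a b c → (c ∙ a) − (c ∙ b) ≡ a − b
  ∙-−-cancelˡ a b c = trans (cong₂ _−_ (comm c a) (comm c b)) (∙-−-cancelʳ a b c)

  −-∙-cancel : ∀ a b c → (a − b) ∙ (b ∙ c) ≡ a ∙ c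
  −-∙-cancel a b c = trans (sym (assoc (a − b) b c)) (cong (_∙ c) (//-rightDividesˡ b a))

  nmul≡· : ∀ n x → nmul G n x ≡ n · x
  nmul≡· zero    x = refl
  nmul≡· (suc n) x = cong (x ∙_) (nmul≡· n x)

  ·-ε : ∀ n → n · ε ≡ ε
  ·-ε zero    = refl
  ·-ε (suc n) = trans (identityˡ (n · ε)) (·-ε n)

  to : Fin (size G) → Carrier G
  to = Inverse.to (enum G)

  from : Carrier G → Fin (size G)
  from = Inverse.from (enum G)

  to-from : ∀ x → to (from x) ≡ x
  to-from = Inverse.strictlyInverseˡ (enum G)

  to-injective : ∀ {i j} → to i ≡ to j → i ≡ j
  to-injective = Injection.injective (↔⇒↣ (enum G))

  from-injective : ∀ {x y} → from x ≡ from y → x ≡ y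
  from-injective = Injection.injective (↔⇒↣ (↔-sym (enum G)))

  _≟_ : DecidableEquality (Carrier G)
  _≟_ = inj⇒≟ (↔⇒↣ (↔-sym (enum G)))

  all-elements? : {P : Pred (Carrier G) 0ℓ} → Decidable P → Dec (∀ x → P x)
  all-elements? {P} P? =
    map′ (λ ∀P x → subst P (to-from x) (∀P (from x))) (λ ∀P → ∀P ∘ to) (all? (P? ∘ to))

  -- Tuples are searched through their codes in Fin (size G ^ k); without function extensionality
  -- decoding a code only gives back a pointwise equal tuple, hence the hypothesis on P.
  ∃-tuple? : ∀ {k} (P : Pred (Fin k → Carrier G) 0ℓ) →
             (∀ {g g′} → (∀ j → g j ≡ g′ j) → P g → P g′) → Decidable P → Dec (∃ P)
  ∃-tuple? P P-resp P? =
    map′ (λ (i , p) → to ∘ finToFun i , p) encode (any? (P? ∘ (to ∘_) ∘ finToFun))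
    where
    decode-encode : ∀ g j → g j ≡ to (finToFun (funToFin (from ∘ g)) j)
    decode-encode g j = sym (trans (cong to (finToFun-funToFin (from ∘ g) j)) (to-from (g j)))
    encode : ∃ P → ∃ λ i → P (to ∘ finToFun i)
    encode (g , p) = funToFin (from ∘ g) , P-resp (decode-encode g) p

  order : ∀ x → ∃[ o ] (suc o · x ≡ ε)
  order x with pigeonhole (n<1+n (size G)) (λ i → from (toℕ i · x))
  ... | i , j , i<j , same-index = o , ∙-cancelˡ (toℕ i · x) (suc o · x) ε (begin
    toℕ i · x ∙ suc o · x  ≡⟨ ×-homo-+ x (toℕ i) (suc o) ⟨
    (toℕ i + suc o) · x    ≡⟨ cong (_· x) (trans (+-suc (toℕ i) o) i+1+o≡j) ⟩
    toℕ j · x              ≡⟨ from-injective same-index ⟨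
    toℕ i · x              ≡⟨ identityʳ (toℕ i · x) ⟨
    toℕ i · x ∙ ε          ∎)
    where
    open ≡-Reasoning
    o = proj₁ (m≤n⇒∃[o]m+o≡n i<j)
    i+1+o≡j : suc (toℕ i + o) ≡ toℕ j
    i+1+o≡j = proj₂ (m≤n⇒∃[o]m+o≡n i<j)

  ·-mod-order : ∀ {o x} → suc o · x ≡ ε → ∀ n → n · x ≡ (n % suc o) · x
  ·-mod-order {o} {x} o-order n = begin
    n · x                          ≡⟨ cong (_· x) (m≡m%n+[m/n]*n n (suc o)) ⟩
    (r + q * suc o) · x            ≡⟨ ×-homo-+ x r (q * suc o) ⟩
    r · x ∙ (q * suc o) · x        ≡⟨ cong (r · x ∙_) (×-assocˡ x q (suc o)) ⟨
    r · x ∙ q · suc o · x          ≡⟨ cong (λ y → r · x ∙ q · y) o-order ⟩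
    r · x ∙ q · ε                  ≡⟨ cong (r · x ∙_) (·-ε q) ⟩
    r · x ∙ ε                      ≡⟨ identityʳ (r · x) ⟩
    r · x                          ∎
    where
    open ≡-Reasoning
    r = n % suc o
    q = n / suc o

  ⁻¹-as-multiple : ∀ n x → ∃[ m ] (m · x ≡ (n · x) ⁻¹)
  ⁻¹-as-multiple n x = n * o , inverseʳ-unique (n · x) ((n * o) · x) (begin
    n · x ∙ (n * o) · x   ≡⟨ ×-homo-+ x n (n * o) ⟨
    (n + n * o) · x       ≡⟨ cong (_· x) (*-suc n o) ⟨
    (n * suc o) · x       ≡⟨ ×-assocˡ x n (suc o) ⟨
    n · suc o · x         ≡⟨ cong (n ·_) o-order ⟩
    n · ε                 ≡⟨ ·-ε n ⟩
    ε                     ∎)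
    where
    open ≡-Reasoning
    o = proj₁ (order x)
    o-order = proj₂ (order x)

  zmul-as-multiple : ∀ a x → ∃[ n ] (zmul G a x ≡ n · x)
  zmul-as-multiple (+ n)    x = n , nmul≡· n x
  zmul-as-multiple -[1+ n ] x =
    let m , m≡ = ⁻¹-as-multiple (suc n) x in m , trans (cong _⁻¹ (nmul≡· (suc n) x)) (sym m≡)

  infix 4 _∈⟨_⟩ _∈⟨_⟩?

  -- Membership in the subgroup generated by hs; natural coefficients suffice as G is finite.
  _∈⟨_⟩ : Carrier G → List (Carrier G) → Set
  x ∈⟨ [] ⟩     = x ≡ ε
  x ∈⟨ h ∷ hs ⟩ = ∃[ n ] (x − n · h ∈⟨ hs ⟩)

  ε∈⟨⟩ : ∀ hs → ε ∈⟨ hs ⟩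
  ε∈⟨⟩ []       = refl
  ε∈⟨⟩ (h ∷ hs) = 0 , subst (_∈⟨ hs ⟩) (sym (x−ε≡x ε)) (ε∈⟨⟩ hs)

  ∙-∈⟨⟩ : ∀ hs {x y} → x ∈⟨ hs ⟩ → y ∈⟨ hs ⟩ → x ∙ y ∈⟨ hs ⟩
  ∙-∈⟨⟩ []       refl     refl     = identityˡ ε
  ∙-∈⟨⟩ (h ∷ hs) {x} {y} (m , x∈) (n , y∈) =
    m + n , subst (_∈⟨ hs ⟩) regroup (∙-∈⟨⟩ hs x∈ y∈)
    where
    regroup : (x − m · h) ∙ (y − n · h) ≡ x ∙ y − (m + n) · h
    regroup = trans (sym (∙-−-interchange x y (m · h) (n · h)))
                    (cong (x ∙ y −_) (sym (×-homo-+ h m n)))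

  ⁻¹-∈⟨⟩ : ∀ hs {x} → x ∈⟨ hs ⟩ → x ⁻¹ ∈⟨ hs ⟩
  ⁻¹-∈⟨⟩ []       refl        = ε⁻¹≈ε
  ⁻¹-∈⟨⟩ (h ∷ hs) {x} (n , x∈) = m , subst (_∈⟨ hs ⟩) regroup (⁻¹-∈⟨⟩ hs x∈)
    where
    m = proj₁ (⁻¹-as-multiple n h)
    regroup : (x − n · h) ⁻¹ ≡ x ⁻¹ − m · h
    regroup = trans (sym (⁻¹-∙-comm x ((n · h) ⁻¹)))
                    (cong (λ y → x ⁻¹ ∙ y ⁻¹) (sym (proj₂ (⁻¹-as-multiple n h))))

  ·-∈⟨⟩ : ∀ hs {x} n → x ∈⟨ hs ⟩ → n · x ∈⟨ hs ⟩
  ·-∈⟨⟩ hs zero    x∈ = ε∈⟨⟩ hs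
  ·-∈⟨⟩ hs (suc n) x∈ = ∙-∈⟨⟩ hs x∈ (·-∈⟨⟩ hs n x∈)

  ∈⟨⟩-∷ : ∀ {h} hs {x} → x ∈⟨ hs ⟩ → x ∈⟨ h ∷ hs ⟩
  ∈⟨⟩-∷ hs {x} x∈ = 0 , subst (_∈⟨ hs ⟩) (sym (x−ε≡x x)) x∈

  ·-∈⟨∷⟩ : ∀ {h} hs n → n · h ∈⟨ h ∷ hs ⟩
  ·-∈⟨∷⟩ hs n = n , subst (_∈⟨ hs ⟩) (sym (inverseʳ _)) (ε∈⟨⟩ hs)

  ∈⇒∈⟨⟩ : ∀ {hs x} → x ∈ hs → x ∈⟨ hs ⟩
  ∈⇒∈⟨⟩ {h ∷ hs} (here refl) = subst (_∈⟨ h ∷ hs ⟩) (identityʳ h) (·-∈⟨∷⟩ hs 1)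
  ∈⇒∈⟨⟩ {h ∷ hs} (there x∈) = ∈⟨⟩-∷ hs (∈⇒∈⟨⟩ x∈)

  _∈⟨_⟩? : ∀ x hs → Dec (x ∈⟨ hs ⟩)
  x ∈⟨ [] ⟩?     = x ≟ ε
  x ∈⟨ h ∷ hs ⟩? =
    map′ (λ (i , x∈) → toℕ i , x∈) reduce (any? λ (i : Fin (suc o)) → x − toℕ i · h ∈⟨ hs ⟩?)
    where
    o = proj₁ (order h)
    reduce : x ∈⟨ h ∷ hs ⟩ → ∃ λ (i : Fin (suc o)) → x − toℕ i · h ∈⟨ hs ⟩
    reduce (n , x∈) = fromℕ< n%o<o , subst (λ y → x − y ∈⟨ hs ⟩) n·h≡ x∈
      where
      n%o<o = m%n<n n (suc o)
      n·h≡ : n · h ≡ toℕ (fromℕ< n%o<o) · h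
      n·h≡ = trans (·-mod-order (proj₂ (order h)) n) (cong (_· h) (sym (toℕ-fromℕ< n%o<o)))

  Spans : List (Carrier G) → Set
  Spans hs = ∀ x → x ∈⟨ hs ⟩

  combination-∈⟨⟩ : ∀ {k} (g : Fin k → Carrier G) (a : Fin k → ℤ) →
                    sumFin G (λ j → zmul G (a j) (g j)) ∈⟨ tabulate g ⟩
  combination-∈⟨⟩ {zero}  g a = refl
  combination-∈⟨⟩ {suc k} g a =
    ∙-∈⟨⟩ (tabulate g) first∈ (∈⟨⟩-∷ _ (combination-∈⟨⟩ (g ∘ suc) (a ∘ suc)))
    where
    first∈ : zmul G (a zero) (g zero) ∈⟨ tabulate g ⟩
    first∈ = let n , zmul≡ = zmul-as-multiple (a zero) (g zero) in
             subst (_∈⟨ tabulate g ⟩) (sym zmul≡) (·-∈⟨∷⟩ _ n)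

  ∈⟨⟩⇒combination : ∀ {k} (g : Fin k → Carrier G) {x} → x ∈⟨ tabulate g ⟩ →
                    Σ (Fin k → ℤ) λ a → x ≡ sumFin G (λ j → zmul G (a j) (g j))
  ∈⟨⟩⇒combination {zero}  g x≡ε = (λ ()) , x≡ε
  ∈⟨⟩⇒combination {suc k} g {x} (n , x∈) =
    let a , x−n·g≡ = ∈⟨⟩⇒combination (g ∘ suc) x∈ in
    (λ { zero → + n ; (suc j) → a j }) , (begin
      x                                    ≡⟨ //-rightDividesˡ (n · g zero) x ⟨
      (x − n · g zero) ∙ n · g zero        ≡⟨ comm _ _ ⟩
      n · g zero ∙ (x − n · g zero)        ≡⟨ cong₂ _∙_ (sym (nmul≡· n (g zero))) x−n·g≡ ⟩
      nmul G n (g zero) ∙ sumFin G (λ j → zmul G (a j) (g (suc j))) ∎)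
    where open ≡-Reasoning

  generates⇒spans : ∀ {k} (g : Fin k → Carrier G) → Generates G g → Spans (tabulate g)
  generates⇒spans g gen x =
    let a , x≡ = gen x in subst (_∈⟨ tabulate g ⟩) (sym x≡) (combination-∈⟨⟩ g a)

  spans⇒generates : ∀ {k} (g : Fin k → Carrier G) → Spans (tabulate g) → Generates G g
  spans⇒generates g spans x = ∈⟨⟩⇒combination g (spans x)

  generators? : Decidable (λ k → Σ (Fin k → Carrier G) (Generates G))
  generators? k =
    map′ (λ (g , spans) → g , spans⇒generates g spans) (λ (g , gen) → g , generates⇒spans g gen)
         (∃-tuple? (Spans ∘ tabulate)
                   (λ g≗g′ spans x → subst (x ∈⟨_⟩) (tabulate-cong g≗g′) (spans x))
                   (λ g → all-elements? (_∈⟨ tabulate g ⟩?)))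

  rank : ∃ (IsRank G)
  rank = least-witness _ generators? (to , spans⇒generates to to-spans)
    where
    to-spans : Spans (tabulate to)
    to-spans x = subst (_∈⟨ tabulate to ⟩) (to-from x) (∈⇒∈⟨⟩ (∈-tabulate⁺ (from x)))

  infix 4 _≋[_]_

  _≋[_]_ : Carrier G → List (Carrier G) → Carrier G → Set
  x ≋[ hs ] y = x − y ∈⟨ hs ⟩

  ≋-refl : ∀ {hs x} → x ≋[ hs ] x
  ≋-refl {hs} {x} = subst (_∈⟨ hs ⟩) (sym (inverseʳ x)) (ε∈⟨⟩ hs)

  ≋-sym : ∀ {hs x y} → x ≋[ hs ] y → y ≋[ hs ] x
  ≋-sym {hs} {x} {y} x≋y = subst (_∈⟨ hs ⟩) (⁻¹-anti-homo‿- x y) (⁻¹-∈⟨⟩ hs x≋y)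

  ≋-trans : ∀ {hs x y z} → x ≋[ hs ] y → y ≋[ hs ] z → x ≋[ hs ] z
  ≋-trans {hs} {x} {y} {z} x≋y y≋z = subst (_∈⟨ hs ⟩) telescope (∙-∈⟨⟩ hs x≋y y≋z)
    where
    open ≡-Reasoning
    telescope : (x − y) ∙ (y − z) ≡ x − z
    telescope = begin
      (x − y) ∙ (y − z)   ≡⟨ ∙-−-interchange x y y z ⟨
      (x ∙ y) − (y ∙ z)   ≡⟨ cong ((x ∙ y) −_) (comm y z) ⟩
      (x ∙ y) − (z ∙ y)   ≡⟨ ∙-−-cancelʳ x z y ⟩
      x − z               ∎

  ≋-setoid : List (Carrier G) → Setoid 0ℓ 0ℓ
  ≋-setoid hs = record
    { _≈_ = _≋[ hs ]_
    ; isEquivalence = record { refl = ≋-refl ; sym = ≋-sym ; trans = ≋-trans } }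

  module ≋-Reasoning (hs : List (Carrier G)) = SetoidReasoning (≋-setoid hs)

  ≋-∙-cong : ∀ {hs x y u v} → x ≋[ hs ] y → u ≋[ hs ] v → x ∙ u ≋[ hs ] y ∙ v
  ≋-∙-cong {hs} {x} {y} {u} {v} x≋y u≋v =
    subst (_∈⟨ hs ⟩) (sym (∙-−-interchange x u y v)) (∙-∈⟨⟩ hs x≋y u≋v)

  ≋-∙-cancelˡ : ∀ {hs x y} z → z ∙ x ≋[ hs ] z ∙ y → x ≋[ hs ] y
  ≋-∙-cancelˡ {hs} {x} {y} z = subst (_∈⟨ hs ⟩) (∙-−-cancelˡ x y z)

  ≋-∷⁻ : ∀ {h hs x y} → x ≋[ h ∷ hs ] y → ∃[ n ] (x ≋[ hs ] y ∙ n · h)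
  ≋-∷⁻ {h} {hs} {x} {y} (n , x≋y) = n , subst (_∈⟨ hs ⟩) (−-∙-assoc x y (n · h)) x≋y

  ·≋ε : ∀ {h} hs n → n · h ≋[ h ∷ hs ] ε
  ·≋ε hs n = subst (_∈⟨ _ ∷ hs ⟩) (sym (x−ε≡x _)) (·-∈⟨∷⟩ hs n)

  ≋ε⇒∈⟨⟩ : ∀ {hs x} → x ≋[ hs ] ε → x ∈⟨ hs ⟩
  ≋ε⇒∈⟨⟩ {hs} {x} = subst (_∈⟨ hs ⟩) (x−ε≡x x)

  ≋[]⇒≡ : ∀ {x y} → x ≋[ [] ] y → x ≡ y
  ≋[]⇒≡ {x} {y} = x∙y⁻¹≈ε⇒x≈y x y

  ≡⇒≋ : ∀ {hs x y} → x ≡ y → x ≋[ hs ] y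
  ≡⇒≋ refl = ≋-refl

  ∈⟨⟩⇒≋ε : ∀ {hs x} → x ∈⟨ hs ⟩ → x ≋[ hs ] ε
  ∈⟨⟩⇒≋ε {hs} {x} = subst (_∈⟨ hs ⟩) (sym (x−ε≡x x))

  x∙n·h≋x : ∀ {h} hs x n → x ∙ n · h ≋[ h ∷ hs ] x
  x∙n·h≋x hs x n = ≋-trans (≋-∙-cong ≋-refl (·≋ε hs n)) (≡⇒≋ (identityʳ x))

  -- rep 0, …, rep last represent the cosets of ⟨hs⟩ and are traversed cyclically: each step
  -- rep (suc r) − rep r lies in steps, and so does the closing step exit (correct up to ⟨hs⟩),
  -- unless there is a single coset.
  record CosetCycle (hs : List (Carrier G)) (t : ℕ) : Set where
    field
      last         : ℕ
      rep          : ℕ → Carrier G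
      steps        : List (Carrier G)
      exit         : Carrier G
      rep-covers   : ∀ x → ∃[ r ] (r < suc last × x ≋[ hs ] rep r)
      rep-distinct : ∀ {r r′} → r < suc last → r′ < suc last → rep r ≋[ hs ] rep r′ → r ≡ r′
      inner-step   : ∀ {r} → r < last → rep (suc r) − rep r ∈ steps
      exit-step    : exit ∙ rep last ≋[ hs ] rep 0
      exit∈steps   : exit ∈ steps ⊎ last ≡ 0
      steps-length : length steps ≤ t

  trivialCosetCycle : ∀ {hs} → Spans hs → CosetCycle hs 0
  trivialCosetCycle {hs} spans = record
    { last         = 0
    ; rep          = λ _ → ε
    ; steps        = []
    ; exit         = ε
    ; rep-covers   = λ x → 0 , s≤s z≤n , ∈⟨⟩⇒≋ε (spans x)
    ; rep-distinct = λ { (s≤s z≤n) (s≤s z≤n) _ → refl }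
    ; inner-step   = λ ()
    ; exit-step    = ≡⇒≋ (identityˡ ε)
    ; exit∈steps   = inj₂ refl
    ; steps-length = z≤n }

  -- m = suc m′ is the order of h modulo ⟨hs⟩, and the index r + s * L with r < L and s < m
  -- lists the representative rep r ∙ s · h.
  module Refine {h hs t} (cyc : CosetCycle (h ∷ hs) t) where
    open CosetCycle cyc

    L : ℕ
    L = suc last

    order-mod-hs : ∃ (IsLeast (λ k → suc k · h ∈⟨ hs ⟩))
    order-mod-hs = least-witness _ (λ k → suc k · h ∈⟨ hs ⟩?) {proj₁ (order h)}
                     (subst (_∈⟨ hs ⟩) (sym (proj₂ (order h))) (ε∈⟨⟩ hs))

    m′ : ℕ
    m′ = proj₁ order-mod-hs

    m : ℕ
    m = suc m′

    m·h∈ : m · h ∈⟨ hs ⟩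
    m·h∈ = proj₁ (proj₂ order-mod-hs)

    m′-least : ∀ k → suc k · h ∈⟨ hs ⟩ → m′ ≤ k
    m′-least = proj₂ (proj₂ order-mod-hs)

    ·h-mod-m : ∀ k → k · h ≋[ hs ] (k % m) · h
    ·h-mod-m k = begin
      k · h                      ≡⟨ cong (_· h) (m≡m%n+[m/n]*n k m) ⟩
      (s + q * m) · h            ≡⟨ ×-homo-+ h s (q * m) ⟩
      s · h ∙ (q * m) · h        ≈⟨ ≋-∙-cong ≋-refl (∈⟨⟩⇒≋ε qm·h∈) ⟩
      s · h ∙ ε                  ≡⟨ identityʳ (s · h) ⟩
      s · h                      ∎
      where
      open ≋-Reasoning hs
      s = k % m
      q = k / m
      qm·h∈ : (q * m) · h ∈⟨ hs ⟩
      qm·h∈ = subst (_∈⟨ hs ⟩) (×-assocˡ h q m) (·-∈⟨⟩ hs q m·h∈)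

    ·h-injective-≤ : ∀ {s s′} → s ≤ s′ → s′ < m → s · h ≋[ hs ] s′ · h → s ≡ s′
    ·h-injective-≤ {s} {s′} s≤s′ s′<m s·h≋s′·h with m≤n⇒∃[o]m+o≡n s≤s′
    ... | zero  , s+0≡s′   = trans (sym (+-identityʳ s)) s+0≡s′
    ... | suc d , s+d+1≡s′ = contradiction (m′-least d d+1·h∈) (<⇒≱ d<m′)
      where
      open ≋-Reasoning hs
      d<m′ : d < m′
      d<m′ = ≤-trans (m≤n+m (suc d) s) (≤-trans (≤-reflexive s+d+1≡s′) (s≤s⁻¹ s′<m))
      d+1·h∈ : suc d · h ∈⟨ hs ⟩
      d+1·h∈ = ≋ε⇒∈⟨⟩ (≋-sym (≋-∙-cancelˡ (s · h) (begin
        s · h ∙ ε              ≡⟨ identityʳ (s · h) ⟩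
        s · h                  ≈⟨ s·h≋s′·h ⟩
        s′ · h                 ≡⟨ cong (_· h) s+d+1≡s′ ⟨
        (s + suc d) · h        ≡⟨ ×-homo-+ h s (suc d) ⟩
        s · h ∙ suc d · h      ∎)))

    ·h-injective : ∀ {s s′} → s < m → s′ < m → s · h ≋[ hs ] s′ · h → s ≡ s′
    ·h-injective {s} {s′} s<m s′<m s·h≋s′·h with ≤-total s s′
    ... | inj₁ s≤s′ = ·h-injective-≤ s≤s′ s′<m s·h≋s′·h
    ... | inj₂ s′≤s = sym (·h-injective-≤ s′≤s s<m (≋-sym s·h≋s′·h))

    last′ : ℕ
    last′ = last + m′ * L

    rep′ : ℕ → Carrier G
    rep′ i = rep (i % L) ∙ (i / L) · h

    rep′-digits : ∀ {r} s → r < L → rep′ (r + s * L) ≡ rep r ∙ s · h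
    rep′-digits s r<L = cong₂ (λ r′ s′ → rep r′ ∙ s′ · h) ([m+kn]%n≡m s r<L) ([m+kn]/n≡k s r<L)

    index-digits : ∀ i → i ≡ i % L + (i / L) * L
    index-digits i = m≡m%n+[m/n]*n i L

    exit′ : Carrier G
    exit′ = (rep 0 ∙ h) − rep last

    rep′-covers : ∀ x → ∃[ i ] (i < suc last′ × x ≋[ hs ] rep′ i)
    rep′-covers x with rep-covers x
    ... | r , r<L , x≋rep-r with ≋-∷⁻ x≋rep-r
    ...   | k , x≋ = r + (k % m) * L , index< , (begin
      x                       ≈⟨ x≋ ⟩
      rep r ∙ k · h           ≈⟨ ≋-∙-cong ≋-refl (·h-mod-m k) ⟩
      rep r ∙ (k % m) · h     ≡⟨ rep′-digits (k % m) r<L ⟨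
      rep′ (r + (k % m) * L)  ∎)
      where
      open ≋-Reasoning hs
      index< : r + (k % m) * L < m * L
      index< = <-≤-trans (+-monoˡ-< ((k % m) * L) r<L) (*-monoˡ-≤ L (m%n<n k m))

    rep′-distinct : ∀ {i i′} → i < suc last′ → i′ < suc last′ → rep′ i ≋[ hs ] rep′ i′ → i ≡ i′
    rep′-distinct {i} {i′} i< i′< rep′≋ =
      trans (index-digits i) (trans (cong₂ (λ r s → r + s * L) r≡r′ s≡s′) (sym (index-digits i′)))
      where
      open ≋-Reasoning (h ∷ hs)
      r = i % L
      s = i / L
      r′ = i′ % L
      s′ = i′ / L
      r≡r′ : r ≡ r′
      r≡r′ = rep-distinct (m%n<n i L) (m%n<n i′ L) (begin
        rep r             ≈⟨ x∙n·h≋x hs (rep r) s ⟨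
        rep r ∙ s · h     ≈⟨ ∈⟨⟩-∷ hs rep′≋ ⟩
        rep r′ ∙ s′ · h   ≈⟨ x∙n·h≋x hs (rep r′) s′ ⟩
        rep r′            ∎)
      same-rep : rep r ∙ s · h ≋[ hs ] rep r ∙ s′ · h
      same-rep = subst (λ r₀ → rep r ∙ s · h ≋[ hs ] rep r₀ ∙ s′ · h) (sym r≡r′) rep′≋
      s≡s′ : s ≡ s′
      s≡s′ = ·h-injective (m<n*o⇒m/o<n i<) (m<n*o⇒m/o<n i′<) (≋-∙-cancelˡ (rep r) same-rep)

    inner-step′ : ∀ i → rep′ (suc i) − rep′ i ∈ exit′ ∷ steps
    inner-step′ i with m≤n⇒m<n∨m≡n (s≤s⁻¹ (m%n<n i L))
    ... | inj₁ r<last = there (subst (_∈ steps) (sym same-block) (inner-step r<last))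
      where
      open ≡-Reasoning
      r = i % L
      s = i / L
      same-block : rep′ (suc i) − rep′ i ≡ rep (suc r) − rep r
      same-block = begin
        rep′ (suc i) − rep′ i
          ≡⟨ cong (λ j → rep′ (suc j) − rep′ i) (index-digits i) ⟩
        rep′ (suc r + s * L) − rep′ i
          ≡⟨ cong (_− rep′ i) (rep′-digits s (s≤s r<last)) ⟩
        (rep (suc r) ∙ s · h) − (rep r ∙ s · h)
          ≡⟨ ∙-−-cancelʳ (rep (suc r)) (rep r) (s · h) ⟩
        rep (suc r) − rep r                    ∎
    ... | inj₂ r≡last = here next-block
      where
      open ≡-Reasoning
      s = i / L
      i≡ : i ≡ last + s * L
      i≡ = trans (index-digits i) (cong (_+ s * L) r≡last)
      next-block : rep′ (suc i) − rep′ i ≡ exit′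
      next-block = begin
        rep′ (suc i) − rep′ i
          ≡⟨ cong (λ j → rep′ (suc j) − rep′ j) i≡ ⟩
        rep′ (0 + suc s * L) − rep′ (last + s * L)
          ≡⟨ cong₂ _−_ (rep′-digits (suc s) (s≤s z≤n)) (rep′-digits s ≤-refl) ⟩
        (rep 0 ∙ (h ∙ s · h)) − (rep last ∙ s · h)
          ≡⟨ cong (_− (rep last ∙ s · h)) (assoc (rep 0) h (s · h)) ⟨
        ((rep 0 ∙ h) ∙ s · h) − (rep last ∙ s · h)
          ≡⟨ ∙-−-cancelʳ (rep 0 ∙ h) (rep last) (s · h) ⟩
        exit′                                        ∎

    exit-step′ : exit′ ∙ rep′ last′ ≋[ hs ] rep′ 0
    exit-step′ = begin
      exit′ ∙ rep′ last′                  ≡⟨ cong (exit′ ∙_) (rep′-digits m′ ≤-refl) ⟩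
      exit′ ∙ (rep last ∙ m′ · h)         ≡⟨ −-∙-cancel (rep 0 ∙ h) (rep last) (m′ · h) ⟩
      (rep 0 ∙ h) ∙ m′ · h                ≡⟨ assoc (rep 0) h (m′ · h) ⟩
      rep 0 ∙ m · h                       ≈⟨ ≋-∙-cong ≋-refl (∈⟨⟩⇒≋ε m·h∈) ⟩
      rep′ 0                              ∎
      where open ≋-Reasoning hs

    refined : CosetCycle hs (suc t)
    refined = record
      { last         = last′
      ; rep          = rep′
      ; steps        = exit′ ∷ steps
      ; exit         = exit′
      ; rep-covers   = rep′-covers
      ; rep-distinct = rep′-distinct
      ; inner-step   = λ {i} _ → inner-step′ i
      ; exit-step    = exit-step′
      ; exit∈steps   = inj₁ (here refl)
      ; steps-length = s≤s steps-length }

  refine-all : ∀ gs {t} → CosetCycle gs t → CosetCycle [] (length gs + t)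
  refine-all []       cyc = cyc
  refine-all (g ∷ gs) {t} cyc =
    subst (CosetCycle []) (+-suc (length gs) t) (refine-all gs (Refine.refined cyc))

  module ToHamCycle {t} (cyc : CosetCycle [] t) (2≤size : 2 ≤ size G) where
    open CosetCycle cyc

    covers : ∀ x → ∃[ r ] (r < suc last × rep r ≡ x)
    covers x = let r , r< , x≋rep-r = rep-covers x in r , r< , sym (≋[]⇒≡ x≋rep-r)

    cover-index : Carrier G → Fin (suc last)
    cover-index x = fromℕ< (proj₁ (proj₂ (covers x)))

    rep-cover-index : ∀ x → rep (toℕ (cover-index x)) ≡ x
    rep-cover-index x = trans (cong rep (toℕ-fromℕ< _)) (proj₂ (proj₂ (covers x)))

    cosets≡size : suc last ≡ size G
    cosets≡size = cantor-schröder-bernstein {f = from ∘ rep ∘ toℕ} {g = cover-index ∘ to}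
      (λ {r} {r′} eq → toℕ-injective (rep-distinct (toℕ<n r) (toℕ<n r′) (≡⇒≋ (from-injective eq))))
      (λ {i} {j} eq → to-injective (trans (sym (rep-cover-index (to i)))
                                      (trans (cong (rep ∘ toℕ) eq) (rep-cover-index (to j)))))

    index< : ∀ (i : Fin (size G)) → toℕ i < suc last
    index< i = subst (toℕ i <_) (sym cosets≡size) (toℕ<n i)

    hamCycle : HamCycle G
    hamCycle = record
      { two≤n      = 2≤size
      ; c          = rep ∘ toℕ
      ; injective  = λ i j eq → toℕ-injective (rep-distinct (index< i) (index< j) (≡⇒≋ eq))
      ; surjective = λ x → let r , r< , rep-r≡x = covers x in
                           fromℕ< (subst (r <_) cosets≡size r<) , trans (cong rep (toℕ-fromℕ< _)) rep-r≡x }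

    exit∈steps′ : exit ∈ steps
    exit∈steps′ with exit∈steps
    ... | inj₁ exit∈  = exit∈
    ... | inj₂ last≡0 = contradiction (subst (2 ≤_) (trans (sym cosets≡size) (cong suc last≡0)) 2≤size)
                                      λ { (s≤s ()) }

    diff∈steps : ∀ i → diff hamCycle i ∈ steps
    diff∈steps i with suc (toℕ i) <? size G
    ... | yes i+1<size =
      subst (_∈ steps) (cong (λ j → rep j − rep (toℕ i)) (sym (toℕ-nextFin-< i i+1<size)))
            (inner-step (s≤s⁻¹ (subst (suc (toℕ i) <_) (sym cosets≡size) i+1<size)))
    ... | no  i+1≮size = subst (_∈ steps) (sym closing) exit∈steps′
      where
      open ≡-Reasoning
      i≡last : toℕ i ≡ last
      i≡last = suc-injective (trans (≤-antisym (toℕ<n i) (≮⇒≥ i+1≮size)) (sym cosets≡size))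
      closing : diff hamCycle i ≡ exit
      closing = begin
        rep (toℕ (nextFin i)) − rep (toℕ i)
          ≡⟨ cong₂ (λ j k → rep j − rep k) (toℕ-nextFin-≮ i i+1≮size) i≡last ⟩
        rep 0 − rep last                      ≡⟨ cong (_− rep last) (≋[]⇒≡ exit-step) ⟨
        (exit ∙ rep last) − rep last          ≡⟨ //-rightDividesʳ (rep last) exit ⟩
        exit                                  ∎

  cycle-with-few-differences : ∀ {k} → 2 ≤ size G → (g : Fin k → Carrier G) → Generates G g →
                               Σ (HamCycle G) λ C → ∃[ d ] (d ≤ k × DiffCard C d)
  cycle-with-few-differences {k} 2≤size g gen =
    let d , d≤|steps| , dC =
          imageCard-≤-length _≟_ (diff C) (steps cyc) (ToHamCycle.diff∈steps cyc 2≤size)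
    in C , d , ≤-trans d≤|steps| (≤-trans (steps-length cyc) |steps|≤k) , dC
    where
    open CosetCycle
    cyc : CosetCycle [] (length (tabulate g) + 0)
    cyc = refine-all (tabulate g) (trivialCosetCycle (generates⇒spans g gen))
    C : HamCycle G
    C = ToHamCycle.hamCycle cyc 2≤size
    |steps|≤k : length (tabulate g) + 0 ≤ k
    |steps|≤k = ≤-reflexive (trans (+-identityʳ _) (length-tabulate g))

  consecutive≋⇒Spans : ∀ {n hs} (c : Fin n → Carrier G) → (∀ x → ∃ λ i → c i ≡ x) →
                       (∀ i → c (nextFin i) ≋[ hs ] c i) → Spans hs
  consecutive≋⇒Spans {zero}       c surjective _    x with () ← proj₁ (surjective x)
  consecutive≋⇒Spans {suc n} {hs} c surjective next x = ≋ε⇒∈⟨⟩ (begin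
    x        ≡⟨ proj₂ (surjective x) ⟨
    c i      ≈⟨ ≋-c₀ i ⟩
    c zero   ≈⟨ ≋-c₀ i₀ ⟨
    c i₀     ≡⟨ proj₂ (surjective ε) ⟩
    ε        ∎)
    where
    open ≋-Reasoning hs
    i = proj₁ (surjective x)
    i₀ = proj₁ (surjective ε)
    ≋-c₀ : ∀ j → c j ≋[ hs ] c zero
    ≋-c₀ = nextFin-induction _ ≋-refl (λ j c-j≋ → ≋-trans (next j) c-j≋)

  differences-generate : (C : HamCycle G) → ∀ {d} → DiffCard C d → Σ (Fin d → Carrier G) (Generates G)
  differences-generate C (e , _ , _ , diff≡e) =
    e , spans⇒generates e (consecutive≋⇒Spans (c C) (surjective C) diff∈⟨e⟩)
    where
    diff∈⟨e⟩ : ∀ i → diff C i ∈⟨ tabulate e ⟩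
    diff∈⟨e⟩ i = let j , diff≡ej = diff≡e i in
                 subst (_∈⟨ tabulate e ⟩) (sym diff≡ej) (∈⇒∈⟨⟩ (∈-tabulate⁺ j))

  trivial-rank : ¬ 2 ≤ size G → IsRank G 0
  trivial-rank 2≰size = ((λ ()) , spans⇒generates (λ ()) all-ε) , λ _ _ → z≤n
    where
    index≡0 : ∀ (i : Fin (size G)) → toℕ i ≡ 0
    index≡0 i = n<1⇒n≡0 (<-≤-trans (toℕ<n i) (s≤s⁻¹ (≰⇒> 2≰size)))
    all-ε : Spans []
    all-ε x = from-injective (toℕ-injective (trans (index≡0 (from x)) (sym (index≡0 (from ε)))))

theorem1 : (G : FinAbGroup) → ∃[ k ] (IsDmin G k × IsRank G k)
theorem1 G with 2 ≤? size G | rank G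
... | no  2≰size | _ = 0 , inj₁ ((λ C → 2≰size (two≤n C)) , refl) , trivial-rank G 2≰size
... | yes 2≤size | k , (g , gen) , k-least with cycle-with-few-differences G 2≤size g gen
...   | C , d , d≤k , dC = k , inj₂ ((C , subst (DiffCard C) d≡k dC) , rank≤) , (g , gen) , k-least
  where
  rank≤ : ∀ d′ → Σ (HamCycle G) (λ C′ → DiffCard C′ d′) → k ≤ d′
  rank≤ d′ (C′ , dC′) = k-least d′ (differences-generate G C′ dC′)
  d≡k : d ≡ k
  d≡k = ≤-antisym d≤k (rank≤ d (C , dC))
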